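{- For every valuation $v$ and every negation normal form $A$: the formula $\mathrm{CNFtoPropF}(\mathrm{MakeCNF}(A))$ has the same truth value under $v$ as $\mathrm{NNFtoPropF}(A)$.
   Context: Fix a set $V$ of propositional variables with decidable equality. Formulas are generated by $\#p$ ($p\in V$), $\bot$, $A\wedge B$, $A\vee B$, $A\to B$; $\neg A:=A\to\bot$, $\top:=\neg\bot$. A valuation is $v:V\to\{\mathrm{true},\mathrm{false}\}$, with truth of formulas defined by the usual boolean clauses ($\bot$ false, $A\to B$ true iff $A$ false or $B$ true). The type NNF is generated by $\mathrm{NPos}(p)$, $\mathrm{NNeg}(p)$ ($p\in V$), $\mathrm{NBot}$, $\mathrm{NTop}$, $\mathrm{NConj}(X,Y)$, $\mathrm{NDisj}(X,Y)$; $\mathrm{NNFtoPropF}$ sends these to $\#p$, $\neg\#p$, $\bot$, $\top$, $X'\wedge Y'$, $X'\vee Y'$ respectively. Literals are $\mathrm{LPos}(p)$, $\mathrm{LNeg}(p)$ ($p\in V$), $\mathrm{LBot}$, $\mathrm{LTop}$, mapped to formulas $\#p,\neg\#p,\bot,\top$. A clause is a finite list of literals and a CNF is a finite list of clauses. $\mathrm{ClausetoPropF}([\,])=\bot$, $\mathrm{ClausetoPropF}(l::c)=l'\vee\mathrm{ClausetoPropF}(c)$ ($l'$ the formula of literal $l$); $\mathrm{CNFtoPropF}([\,])=\top$, $\mathrm{CNFtoPropF}(c::ll)=\mathrm{ClausetoPropF}(c)\wedge\mathrm{CNFtoPropF}(ll)$. For a clause $c$ and CNF $ll$, $\mathrm{AddClause}(c,ll)$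 is the list obtained by replacing each clause $c_2$ of $ll$ by the concatenation $c\mathbin{++}c_2$; $\mathrm{Disjunct}(ll_1,ll_2)$ is the concatenation, over the clauses $c$ of $ll_1$ in order, of $\mathrm{AddClause}(c,ll_2)$. $\mathrm{MakeCNF}$ from NNF to CNF: $\mathrm{NPos}(p)\mapsto[[\mathrm{LPos}(p)]]$, $\mathrm{NNeg}(p)\mapsto[[\mathrm{LNeg}(p)]]$, $\mathrm{NBot}\mapsto[[\mathrm{LBot}]]$, $\mathrm{NTop}\mapsto[[\mathrm{LTop}]]$, $\mathrm{NConj}(B,C)\mapsto\mathrm{MakeCNF}(B)\mathbin{++}\mathrm{MakeCNF}(C)$, $\mathrm{NDisj}(B,C)\mapsto\mathrm{Disjunct}(\mathrm{MakeCNF}(B),\mathrm{MakeCNF}(C))$. -}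

module Defs where

open import Data.Bool using (Bool; true; false; _∧_; _∨_; not)
open import Data.List using (List; []; _∷_; _++_; map; concatMap)
open import Relation.Binary.Definitions using (DecidableEquality)

module Prop (V : Set) (_≟V_ : DecidableEquality V) where

  infixr 6 _∧'_
  infixr 5 _∨'_
  infixr 4 _⇒_

  data PropF : Set where
    #_   : V → PropF
    ⊥'   : PropF
    _∧'_ : PropF → PropF → PropF
    _∨'_ : PropF → PropF → PropF
    _⇒_  : PropF → PropF → PropF

  ¬'_ : PropF → PropF
  ¬' A = A ⇒ ⊥'

  ⊤' : PropF
  ⊤' = ¬' ⊥'

  Valuation : Set
  Valuation = V → Bool

  TrueQ : Valuation → PropF → Bool
  TrueQ v (# p)    = v p
  TrueQ v ⊥'       = false
  TrueQ v (A ∧' B) = TrueQ v A ∧ TrueQ v B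
  TrueQ v (A ∨' B) = TrueQ v A ∨ TrueQ v B
  TrueQ v (A ⇒ B)  = not (TrueQ v A) ∨ TrueQ v B

  data NNF : Set where
    NPos NNeg    : V → NNF
    NBot NTop    : NNF
    NConj NDisj  : NNF → NNF → NNF

  NNFtoPropF : NNF → PropF
  NNFtoPropF (NPos p)    = # p
  NNFtoPropF (NNeg p)    = ¬' (# p)
  NNFtoPropF NBot        = ⊥'
  NNFtoPropF NTop        = ⊤'
  NNFtoPropF (NConj X Y) = NNFtoPropF X ∧' NNFtoPropF Y
  NNFtoPropF (NDisj X Y) = NNFtoPropF X ∨' NNFtoPropF Y

  data Literal : Set where
    LPos LNeg : V → Literal
    LBot LTop : Literal

  Clause : Set
  Clause = List Literal

  CNF : Set
  CNF = List Clause

  LiteraltoPropF : Literal → PropF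
  LiteraltoPropF (LPos p) = # p
  LiteraltoPropF (LNeg p) = ¬' (# p)
  LiteraltoPropF LBot     = ⊥'
  LiteraltoPropF LTop     = ⊤'

  ClausetoPropF : Clause → PropF
  ClausetoPropF []      = ⊥'
  ClausetoPropF (l ∷ c) = LiteraltoPropF l ∨' ClausetoPropF c

  CNFtoPropF : CNF → PropF
  CNFtoPropF []       = ⊤'
  CNFtoPropF (c ∷ ll) = ClausetoPropF c ∧' CNFtoPropF ll

  AddClause : Clause → CNF → CNF
  AddClause c ll = map (λ c₂ → c ++ c₂) ll

  Disjunct : CNF → CNF → CNF
  Disjunct ll₁ ll₂ = concatMap (λ c → AddClause c ll₂) ll₁

  MakeCNF : NNF → CNF
  MakeCNF (NPos p)    = (LPos p ∷ []) ∷ []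
  MakeCNF (NNeg p)    = (LNeg p ∷ []) ∷ []
  MakeCNF NBot        = (LBot ∷ []) ∷ []
  MakeCNF NTop        = (LTop ∷ []) ∷ []
  MakeCNF (NConj B C) = MakeCNF B ++ MakeCNF C
  MakeCNF (NDisj B C) = Disjunct (MakeCNF B) (MakeCNF C)

module Submission where

-- Write ⟦ X ⟧ for the truth value under a fixed valuation.  The proof is a
-- structural induction on the NNF, reducing each translation clause to a law
-- of the boolean algebra of truth values:
--   * a clause is a disjunction and a CNF a conjunction, so concatenation of
--     clauses is ∨ and concatenation of CNFs is ∧ (clause++ and cnf++);
--   * prefixing a clause c to every clause of a CNF computes ⟦c⟧ ∨ ⟦ll⟧, by
--     distributivity of ∨ over ∧ (addClause);
--   * hence Disjunct computes the disjunction of two CNFs, again by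
--     distributivity, now on the right (disjunct);
--   * a single-literal CNF has the value of its literal (unitCNF).

open import Defs
open import Data.Bool using (Bool; true; false; _∧_; _∨_)
open import Data.Bool.Properties
  using (∨-assoc; ∧-assoc; ∨-distribˡ-∧; ∨-distribʳ-∧; ∨-zeroʳ; ∨-identityʳ; ∧-identityʳ)
open import Data.List using ([]; _∷_; _++_)
open import Relation.Binary.PropositionalEquality using (_≡_; refl; sym; cong; cong₂)
open import Relation.Binary.Definitions using (DecidableEquality)
open Relation.Binary.PropositionalEquality.≡-Reasoning

module Semantics (V : Set) (_≟V_ : DecidableEquality V) (v : Prop.Valuation V _≟V_) where
  open Prop V _≟V_

  ⟦_⟧ : PropF → Bool
  ⟦_⟧ = TrueQ v

  clause++ : ∀ c₁ c₂ →
    ⟦ ClausetoPropF (c₁ ++ c₂) ⟧ ≡ ⟦ ClausetoPropF c₁ ⟧ ∨ ⟦ ClausetoPropF c₂ ⟧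
  clause++ []       c₂ = refl
  clause++ (l ∷ c₁) c₂ = begin
    ⟦ LiteraltoPropF l ⟧ ∨ ⟦ ClausetoPropF (c₁ ++ c₂) ⟧
      ≡⟨ cong (⟦ LiteraltoPropF l ⟧ ∨_) (clause++ c₁ c₂) ⟩
    ⟦ LiteraltoPropF l ⟧ ∨ (⟦ ClausetoPropF c₁ ⟧ ∨ ⟦ ClausetoPropF c₂ ⟧)
      ≡⟨ sym (∨-assoc ⟦ LiteraltoPropF l ⟧ _ _) ⟩
    (⟦ LiteraltoPropF l ⟧ ∨ ⟦ ClausetoPropF c₁ ⟧) ∨ ⟦ ClausetoPropF c₂ ⟧
      ∎

  cnf++ : ∀ ll₁ ll₂ →
    ⟦ CNFtoPropF (ll₁ ++ ll₂) ⟧ ≡ ⟦ CNFtoPropF ll₁ ⟧ ∧ ⟦ CNFtoPropF ll₂ ⟧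
  cnf++ []        ll₂ = refl
  cnf++ (c ∷ ll₁) ll₂ = begin
    ⟦ ClausetoPropF c ⟧ ∧ ⟦ CNFtoPropF (ll₁ ++ ll₂) ⟧
      ≡⟨ cong (⟦ ClausetoPropF c ⟧ ∧_) (cnf++ ll₁ ll₂) ⟩
    ⟦ ClausetoPropF c ⟧ ∧ (⟦ CNFtoPropF ll₁ ⟧ ∧ ⟦ CNFtoPropF ll₂ ⟧)
      ≡⟨ sym (∧-assoc ⟦ ClausetoPropF c ⟧ _ _) ⟩
    (⟦ ClausetoPropF c ⟧ ∧ ⟦ CNFtoPropF ll₁ ⟧) ∧ ⟦ CNFtoPropF ll₂ ⟧
      ∎

  addClause : ∀ c ll →
    ⟦ CNFtoPropF (AddClause c ll) ⟧ ≡ ⟦ ClausetoPropF c ⟧ ∨ ⟦ CNFtoPropF ll ⟧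
  addClause c []        = sym (∨-zeroʳ ⟦ ClausetoPropF c ⟧)
  addClause c (c₂ ∷ ll) = begin
    ⟦ ClausetoPropF (c ++ c₂) ⟧ ∧ ⟦ CNFtoPropF (AddClause c ll) ⟧
      ≡⟨ cong₂ _∧_ (clause++ c c₂) (addClause c ll) ⟩
    (⟦ ClausetoPropF c ⟧ ∨ ⟦ ClausetoPropF c₂ ⟧) ∧ (⟦ ClausetoPropF c ⟧ ∨ ⟦ CNFtoPropF ll ⟧)
      ≡⟨ sym (∨-distribˡ-∧ ⟦ ClausetoPropF c ⟧ _ _) ⟩
    ⟦ ClausetoPropF c ⟧ ∨ (⟦ ClausetoPropF c₂ ⟧ ∧ ⟦ CNFtoPropF ll ⟧)
      ∎

  disjunct : ∀ ll₁ ll₂ →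
    ⟦ CNFtoPropF (Disjunct ll₁ ll₂) ⟧ ≡ ⟦ CNFtoPropF ll₁ ⟧ ∨ ⟦ CNFtoPropF ll₂ ⟧
  disjunct []        ll₂ = refl
  disjunct (c ∷ ll₁) ll₂ = begin
    ⟦ CNFtoPropF (AddClause c ll₂ ++ Disjunct ll₁ ll₂) ⟧
      ≡⟨ cnf++ (AddClause c ll₂) (Disjunct ll₁ ll₂) ⟩
    ⟦ CNFtoPropF (AddClause c ll₂) ⟧ ∧ ⟦ CNFtoPropF (Disjunct ll₁ ll₂) ⟧
      ≡⟨ cong₂ _∧_ (addClause c ll₂) (disjunct ll₁ ll₂) ⟩
    (⟦ ClausetoPropF c ⟧ ∨ ⟦ CNFtoPropF ll₂ ⟧) ∧ (⟦ CNFtoPropF ll₁ ⟧ ∨ ⟦ CNFtoPropF ll₂ ⟧)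
      ≡⟨ sym (∨-distribʳ-∧ ⟦ CNFtoPropF ll₂ ⟧ ⟦ ClausetoPropF c ⟧ _) ⟩
    (⟦ ClausetoPropF c ⟧ ∧ ⟦ CNFtoPropF ll₁ ⟧) ∨ ⟦ CNFtoPropF ll₂ ⟧
      ∎

  unitCNF : ∀ l → ⟦ CNFtoPropF ((l ∷ []) ∷ []) ⟧ ≡ ⟦ LiteraltoPropF l ⟧
  unitCNF l = begin
    (⟦ LiteraltoPropF l ⟧ ∨ false) ∧ true
      ≡⟨ ∧-identityʳ _ ⟩
    ⟦ LiteraltoPropF l ⟧ ∨ false
      ≡⟨ ∨-identityʳ _ ⟩
    ⟦ LiteraltoPropF l ⟧
      ∎

  makeCNF-correct : ∀ A → ⟦ CNFtoPropF (MakeCNF A) ⟧ ≡ ⟦ NNFtoPropF A ⟧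
  makeCNF-correct (NPos p)    = unitCNF (LPos p)
  makeCNF-correct (NNeg p)    = unitCNF (LNeg p)
  makeCNF-correct NBot        = unitCNF LBot
  makeCNF-correct NTop        = unitCNF LTop
  makeCNF-correct (NConj A B) = begin
    ⟦ CNFtoPropF (MakeCNF A ++ MakeCNF B) ⟧
      ≡⟨ cnf++ (MakeCNF A) (MakeCNF B) ⟩
    ⟦ CNFtoPropF (MakeCNF A) ⟧ ∧ ⟦ CNFtoPropF (MakeCNF B) ⟧
      ≡⟨ cong₂ _∧_ (makeCNF-correct A) (makeCNF-correct B) ⟩
    ⟦ NNFtoPropF A ⟧ ∧ ⟦ NNFtoPropF B ⟧
      ∎
  makeCNF-correct (NDisj A B) = begin
    ⟦ CNFtoPropF (Disjunct (MakeCNF A) (MakeCNF B)) ⟧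
      ≡⟨ disjunct (MakeCNF A) (MakeCNF B) ⟩
    ⟦ CNFtoPropF (MakeCNF A) ⟧ ∨ ⟦ CNFtoPropF (MakeCNF B) ⟧
      ≡⟨ cong₂ _∨_ (makeCNF-correct A) (makeCNF-correct B) ⟩
    ⟦ NNFtoPropF A ⟧ ∨ ⟦ NNFtoPropF B ⟧
      ∎

mainTheorem4 : (V : Set) (_≟V_ : DecidableEquality V) (v : Prop.Valuation V _≟V_) (A : Prop.NNF V _≟V_) → Prop.TrueQ V _≟V_ v (Prop.CNFtoPropF V _≟V_ (Prop.MakeCNF V _≟V_ A)) ≡ Prop.TrueQ V _≟V_ v (Prop.NNFtoPropF V _≟V_ A)
mainTheorem4 V _≟V_ v A = Semantics.makeCNF-correct V _≟V_ v A
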